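{- Let $k, s_1, s_2$ be positive integers. If the diophantine system $$\sum_{i=1}^{s_1} x_i^r=\sum_{i=1}^{s_2} y_i^r,\qquad r=1,2,\ldots,k,$$ has a nontrivial integer solution, then $\max(s_1,s_2)\ge k+1$. Further, if $k\ge 4$, then $\min(s_1,s_2)\ge 2$.
   Context: A solution in integers $x_1,\dots,x_{s_1},y_1,\dots,y_{s_2}$ of the system is called trivial if, after interchanging the two sides if necessary so that $s_1\le s_2$, one has $y_i=0$ for $s_2-s_1$ values of $i$ and the remaining $s_1$ integers $y_i$ are a permutation of $x_1,\dots,x_{s_1}$; otherwise it is nontrivial. -}

module Defs where

open import Data.Nat using (ℕ; _≤_; _∸_)
open import Data.Integer using (ℤ; _^_; 0ℤ; _+_)
open import Data.List using (List; foldr; map; replicate; _++_)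
open import Data.Vec using (Vec; toList)
open import Data.Sum using (_⊎_)
open import Data.Product using (_×_)
open import Relation.Binary.PropositionalEquality using (_≡_)
open import Data.List.Relation.Binary.Permutation.Propositional using (_↭_)

powSum : {s : ℕ} → Vec ℤ s → ℕ → ℤ
powSum xs r = foldr _+_ 0ℤ (map (λ x → x ^ r) (toList xs))

IsSolution : (k : ℕ) {s₁ s₂ : ℕ} → Vec ℤ s₁ → Vec ℤ s₂ → Set
IsSolution k xs ys = ∀ r → 1 ≤ r → r ≤ k → powSum xs r ≡ powSum ys r

Trivial : {s₁ s₂ : ℕ} → Vec ℤ s₁ → Vec ℤ s₂ → Set
Trivial {s₁} {s₂} xs ys =
  (s₁ ≤ s₂ × (toList ys ↭ (toList xs ++ replicate (s₂ ∸ s₁) 0ℤ)))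
  ⊎ (s₂ ≤ s₁ × (toList xs ↭ (toList ys ++ replicate (s₁ ∸ s₂) 0ℤ)))

{-# OPTIONS --safe #-}
-- Newton's identities, written as the power-series identity θE + E·P = 0 (θ = t d/dt)
-- for E = ∏ (1 - y t) and P = Σ_{r ≥ 1} p_r t^r, show that the power sums p_1, …, p_n
-- of a list of length n determine the coefficients of E, hence the polynomial
-- ∏ (t - y), hence the list up to order.  If s₁, s₂ ≤ k, padding the shorter side
-- with zeros therefore makes the solution trivial.
-- If s₁ = 1 and k ≥ 4, then Σ y² = x² and Σ y⁴ = x⁴ = (Σ y²)², so all cross terms
-- y_i² y_j² vanish: at most one y is nonzero, and it equals x by the case r = 1.
module Submission where

open import Defs
open import Data.Nat.Base as ℕ using (ℕ; zero; suc; z≤n; s≤s; _≤_; _<_; _⊔_; _⊓_; _∸_)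
import Data.Nat.Properties as ℕ
open import Data.Nat.ListAction using (sum)
import Data.Nat.Tactic.RingSolver as ℕ-Solver
open import Data.Integer.Base using (ℤ; +_; -[1+_]; 0ℤ; 1ℤ; -_; _-_; _+_; _*_; _^_; ∣_∣)
open import Data.Integer.Properties
open import Data.Integer.Tactic.RingSolver using (solve-∀)
open import Algebra.Properties.AbelianGroup +-0-abelianGroup using (∙-cancelˡ; ∙-cancelʳ)
open import Algebra.Properties.CommutativeSemigroup +-commutativeSemigroup using (interchange)
open import Algebra.Properties.CommutativeSemigroup *-commutativeSemigroup using (x∙yz≈y∙xz)
open import Data.List.Base using (List; []; _∷_; foldr; map; length; replicate; _++_; [_])
open import Data.List.Properties using (length-++; length-replicate; map-∘)
open import Data.List.Membership.Propositional using (_∈_)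
open import Data.List.Membership.Propositional.Properties using (∈-∃++)
open import Data.List.Relation.Unary.Any using (here; there)
open import Data.List.Relation.Binary.Permutation.Propositional
  using (_↭_; prep; swap; ↭-refl; ↭-reflexive; ↭-sym; ↭-trans; ↭⇒↭ₛ)
open import Data.List.Relation.Binary.Permutation.Propositional.Properties
  using (map⁺; ↭-length) renaming (shift to ↭-shift)
open import Data.List.Relation.Binary.Permutation.Setoid.Properties using (foldr-commMonoid)
open import Data.Vec.Base using (Vec; []; _∷_; toList)
open import Data.Vec.Properties using (length-toList)
open import Data.Product.Base using (_×_; _,_; ∃)
open import Data.Sum.Base using (_⊎_; inj₁; inj₂; [_,_]′; reduce)
import Data.Sum.Base as Sum
open import Data.Empty using (⊥-elim)
open import Function.Base using (_∘_)
open import Relation.Nullary using (¬_; yes; no)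
open import Relation.Binary.PropositionalEquality
  using (_≡_; _≗_; refl; sym; trans; cong; cong₂; subst; setoid; module ≡-Reasoning)

open ≡-Reasoning

powerSum : List ℤ → ℕ → ℤ
powerSum L r = foldr _+_ 0ℤ (map (_^ r) L)

powerSum-↭ : ∀ {L L'} r → L ↭ L' → powerSum L r ≡ powerSum L' r
powerSum-↭ r p = foldr-commMonoid (setoid ℤ) +-0-isCommutativeMonoid (↭⇒↭ₛ (map⁺ (_^ r) p))

powerSum-padding : ∀ L m r → powerSum (L ++ replicate m 0ℤ) (suc r) ≡ powerSum L (suc r)
powerSum-padding []      zero    r = refl
powerSum-padding []      (suc m) r = cong (λ p → 0ℤ ^ suc r + p) (powerSum-padding [] m r)
powerSum-padding (y ∷ L) m       r = cong (λ p → y ^ suc r + p) (powerSum-padding L m r)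

Series : Set
Series = ℕ → ℤ

0ˢ : Series
0ˢ _ = 0ℤ

1ˢ : Series
1ˢ zero    = 1ℤ
1ˢ (suc _) = 0ℤ

infixl 6 _⊕_
infixr 8 _·_
infixl 7 _⊛_
infixr 8 ⟨1-_t⟩_

_⊕_ : Series → Series → Series
(F ⊕ G) j = F j + G j

_·_ : ℤ → Series → Series
(c · F) j = c * F j

shift : Series → Series
shift F zero    = 0ℤ
shift F (suc j) = F j

-- The Cauchy product, (a ⊛ b) j = Σ_{i ≤ j} a i * b (j ∸ i), by recursion on a.
_⊛_ : Series → Series → Series
(a ⊛ b) zero    = a 0 * b 0
(a ⊛ b) (suc j) = a 0 * b (suc j) + (a ∘ suc ⊛ b) j

shift-cong : ∀ {F G} → F ≗ G → shift F ≗ shift G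
shift-cong e zero    = refl
shift-cong e (suc j) = e j

⊛-congʳ : ∀ a {b b'} → b ≗ b' → a ⊛ b ≗ a ⊛ b'
⊛-congʳ a e zero    = cong (a 0 *_) (e 0)
⊛-congʳ a e (suc j) = cong₂ _+_ (cong (a 0 *_) (e (suc j))) (⊛-congʳ (a ∘ suc) e j)

⊛-zeroʳ : ∀ a → a ⊛ 0ˢ ≗ 0ˢ
⊛-zeroʳ a zero    = *-zeroʳ (a 0)
⊛-zeroʳ a (suc j) = cong₂ _+_ (*-zeroʳ (a 0)) (⊛-zeroʳ (a ∘ suc) j)

⊛-identityʳ : ∀ a → a ⊛ 1ˢ ≗ a
⊛-identityʳ a zero    = *-identityʳ (a 0)
⊛-identityʳ a (suc j) =
  trans (cong₂ _+_ (*-zeroʳ (a 0)) (⊛-identityʳ (a ∘ suc) j)) (+-identityˡ (a (suc j)))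

⊛-distribʳ-⊕ : ∀ a a' b → (a ⊕ a') ⊛ b ≗ a ⊛ b ⊕ a' ⊛ b
⊛-distribʳ-⊕ a a' b zero    = *-distribʳ-+ (b 0) (a 0) (a' 0)
⊛-distribʳ-⊕ a a' b (suc j) =
  trans (cong₂ _+_ (*-distribʳ-+ (b (suc j)) (a 0) (a' 0)) (⊛-distribʳ-⊕ (a ∘ suc) (a' ∘ suc) b j))
        (interchange (a 0 * b (suc j)) (a' 0 * b (suc j)) ((a ∘ suc ⊛ b) j) ((a' ∘ suc ⊛ b) j))

⊛-distribˡ-⊕ : ∀ a b b' → a ⊛ (b ⊕ b') ≗ a ⊛ b ⊕ a ⊛ b'
⊛-distribˡ-⊕ a b b' zero    = *-distribˡ-+ (a 0) (b 0) (b' 0)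
⊛-distribˡ-⊕ a b b' (suc j) =
  trans (cong₂ _+_ (*-distribˡ-+ (a 0) (b (suc j)) (b' (suc j))) (⊛-distribˡ-⊕ (a ∘ suc) b b' j))
        (interchange (a 0 * b (suc j)) (a 0 * b' (suc j)) ((a ∘ suc ⊛ b) j) ((a ∘ suc ⊛ b') j))

·-⊛ : ∀ c a b → c · a ⊛ b ≗ c · (a ⊛ b)
·-⊛ c a b zero    = *-assoc c (a 0) (b 0)
·-⊛ c a b (suc j) =
  trans (cong₂ _+_ (*-assoc c (a 0) (b (suc j))) (·-⊛ c (a ∘ suc) b j)) (sym (*-distribˡ-+ c _ _))

⊛-· : ∀ c a b → a ⊛ c · b ≗ c · (a ⊛ b)
⊛-· c a b zero    = x∙yz≈y∙xz (a 0) c (b 0)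
⊛-· c a b (suc j) =
  trans (cong₂ _+_ (x∙yz≈y∙xz (a 0) c (b (suc j))) (⊛-· c (a ∘ suc) b j)) (sym (*-distribˡ-+ c _ _))

shift-⊛ : ∀ a b → shift a ⊛ b ≗ shift (a ⊛ b)
shift-⊛ a b zero    = refl
shift-⊛ a b (suc j) = +-identityˡ ((a ⊛ b) j)

⊛-shift : ∀ a b → a ⊛ shift b ≗ shift (a ⊛ b)
⊛-shift a b zero          = *-zeroʳ (a 0)
⊛-shift a b (suc zero)    = trans (cong (λ v → a 0 * b 0 + v) (⊛-shift (a ∘ suc) b 0)) (+-identityʳ _)
⊛-shift a b (suc (suc j)) = cong (λ v → a 0 * b (suc j) + v) (⊛-shift (a ∘ suc) b (suc j))

shift-⊕ : ∀ F G → shift (F ⊕ G) ≗ shift F ⊕ shift G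
shift-⊕ F G zero    = refl
shift-⊕ F G (suc j) = refl

⟨1-_t⟩_ : ℤ → Series → Series
⟨1- x t⟩ F = F ⊕ (- x) · shift F

⟨1-t⟩-cong : ∀ x {F G} → F ≗ G → ⟨1- x t⟩ F ≗ ⟨1- x t⟩ G
⟨1-t⟩-cong x e j = cong₂ (λ u v → u + - x * v) (e j) (shift-cong e j)

⟨1-t⟩-zero : ∀ x → ⟨1- x t⟩ 0ˢ ≗ 0ˢ
⟨1-t⟩-zero x zero    = trans (+-identityˡ _) (*-zeroʳ (- x))
⟨1-t⟩-zero x (suc j) = trans (+-identityˡ _) (*-zeroʳ (- x))

⟨1-t⟩-⊕ : ∀ x F G → ⟨1- x t⟩ (F ⊕ G) ≗ ⟨1- x t⟩ F ⊕ ⟨1- x t⟩ G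
⟨1-t⟩-⊕ x F G j = trans (cong (λ v → F j + G j + - x * v) (shift-⊕ F G j))
                        (distribute (F j) (G j) (shift F j) (shift G j) (- x))
  where
  distribute : ∀ p q u v c → p + q + c * (u + v) ≡ (p + c * u) + (q + c * v)
  distribute = solve-∀

⟨1-t⟩-⊛ : ∀ x a b → (⟨1- x t⟩ a) ⊛ b ≗ ⟨1- x t⟩ (a ⊛ b)
⟨1-t⟩-⊛ x a b j = begin
  ((⟨1- x t⟩ a) ⊛ b) j                ≡⟨ ⊛-distribʳ-⊕ a ((- x) · shift a) b j ⟩
  (a ⊛ b) j + ((- x) · shift a ⊛ b) j ≡⟨ cong (λ v → (a ⊛ b) j + v) (·-⊛ (- x) (shift a) b j) ⟩
  (a ⊛ b) j + - x * (shift a ⊛ b) j   ≡⟨ cong (λ v → (a ⊛ b) j + - x * v) (shift-⊛ a b j) ⟩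
  (⟨1- x t⟩ (a ⊛ b)) j                ∎

⊛-⟨1-t⟩ : ∀ x a b → a ⊛ (⟨1- x t⟩ b) ≗ ⟨1- x t⟩ (a ⊛ b)
⊛-⟨1-t⟩ x a b j = begin
  (a ⊛ (⟨1- x t⟩ b)) j                ≡⟨ ⊛-distribˡ-⊕ a b ((- x) · shift b) j ⟩
  (a ⊛ b) j + (a ⊛ (- x) · shift b) j ≡⟨ cong (λ v → (a ⊛ b) j + v) (⊛-· (- x) a (shift b) j) ⟩
  (a ⊛ b) j + - x * (a ⊛ shift b) j   ≡⟨ cong (λ v → (a ⊛ b) j + - x * v) (⊛-shift a b j) ⟩
  (⟨1- x t⟩ (a ⊛ b)) j                ∎

θ : Series → Series
θ F j = + j * F j

θ-⟨1-t⟩ : ∀ x F → θ (⟨1- x t⟩ F) ≗ ⟨1- x t⟩ θ F ⊕ (- x) · shift F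
θ-⟨1-t⟩ x F zero    = absorb (- x)
  where
  absorb : ∀ c → 0ℤ ≡ 0ℤ + c * 0ℤ + c * 0ℤ
  absorb = solve-∀
θ-⟨1-t⟩ x F (suc j) = leibniz (+ j) (F (suc j)) (F j) (- x)
  where
  leibniz : ∀ n e e' c → (1ℤ + n) * (e + c * e') ≡ (1ℤ + n) * e + c * (n * e') + c * e'
  leibniz = solve-∀

elementary : List ℤ → Series
elementary []      = 1ˢ
elementary (y ∷ L) = ⟨1- y t⟩ elementary L

powerSumSeries : List ℤ → Series
powerSumSeries L = shift (λ r → powerSum L (suc r))

geometric : ℤ → Series
geometric x = shift (λ r → x ^ suc r)

powerSumSeries-∷ : ∀ x L → powerSumSeries (x ∷ L) ≗ geometric x ⊕ powerSumSeries L
powerSumSeries-∷ x L zero    = refl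
powerSumSeries-∷ x L (suc j) = refl

⟨1-t⟩-geometric : ∀ x → ⟨1- x t⟩ geometric x ≗ x · shift 1ˢ
⟨1-t⟩-geometric x zero          = trans (+-identityˡ _) (trans (*-zeroʳ (- x)) (sym (*-zeroʳ x)))
⟨1-t⟩-geometric x (suc zero)    = trans (cong (λ v → x ^ 1 + v) (*-zeroʳ (- x))) (+-identityʳ (x ^ 1))
⟨1-t⟩-geometric x (suc (suc j)) = telescope x (x ^ suc j)
  where
  telescope : ∀ x p → x * p + - x * p ≡ x * 0ℤ
  telescope = solve-∀

newtonSeries : List ℤ → Series
newtonSeries L = θ (elementary L) ⊕ elementary L ⊛ powerSumSeries L

newtonSeries-∷ : ∀ x L → newtonSeries (x ∷ L) ≗ ⟨1- x t⟩ newtonSeries L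
newtonSeries-∷ x L j = begin
  θ (⟨1- x t⟩ E) j + ((⟨1- x t⟩ E) ⊛ powerSumSeries (x ∷ L)) j
    ≡⟨ cong₂ _+_ (θ-⟨1-t⟩ x E j) (⊛-congʳ (⟨1- x t⟩ E) (powerSumSeries-∷ x L) j) ⟩
  D + - x * shift E j + ((⟨1- x t⟩ E) ⊛ (geometric x ⊕ P)) j
    ≡⟨ cong (λ v → D + - x * shift E j + v) (⊛-distribˡ-⊕ (⟨1- x t⟩ E) (geometric x) P j) ⟩
  D + - x * shift E j + (((⟨1- x t⟩ E) ⊛ geometric x) j + ((⟨1- x t⟩ E) ⊛ P) j)
    ≡⟨ cong₂ (λ u v → D + - x * shift E j + (u + v)) (factor-geometric j) (⟨1-t⟩-⊛ x E P j) ⟩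
  D + - x * shift E j + (x * shift E j + C)
    ≡⟨ cancel D C (shift E j) x ⟩
  D + C
    ≡⟨ ⟨1-t⟩-⊕ x (θ E) (E ⊛ P) j ⟨
  (⟨1- x t⟩ newtonSeries L) j ∎
  where
  E P : Series
  E = elementary L
  P = powerSumSeries L
  D C : ℤ
  D = (⟨1- x t⟩ θ E) j
  C = (⟨1- x t⟩ (E ⊛ P)) j
  cancel : ∀ a b s x → a + - x * s + (x * s + b) ≡ a + b
  cancel = solve-∀
  factor-geometric : (⟨1- x t⟩ E) ⊛ geometric x ≗ x · shift E
  factor-geometric i = begin
    ((⟨1- x t⟩ E) ⊛ geometric x) i ≡⟨ ⟨1-t⟩-⊛ x E (geometric x) i ⟩
    (⟨1- x t⟩ (E ⊛ geometric x)) i ≡⟨ ⊛-⟨1-t⟩ x E (geometric x) i ⟨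
    (E ⊛ (⟨1- x t⟩ geometric x)) i ≡⟨ ⊛-congʳ E (⟨1-t⟩-geometric x) i ⟩
    (E ⊛ x · shift 1ˢ) i           ≡⟨ ⊛-· x E (shift 1ˢ) i ⟩
    x * (E ⊛ shift 1ˢ) i           ≡⟨ cong (x *_) (⊛-shift E 1ˢ i) ⟩
    x * shift (E ⊛ 1ˢ) i           ≡⟨ cong (x *_) (shift-cong (⊛-identityʳ E) i) ⟩
    x * shift E i                  ∎

newton : ∀ L → newtonSeries L ≗ 0ˢ
newton []      j = cong₂ _+_ (θ-1ˢ j) (trans (⊛-congʳ 1ˢ powerSumSeries-[] j) (⊛-zeroʳ 1ˢ j))
  where
  θ-1ˢ : θ 1ˢ ≗ 0ˢ
  θ-1ˢ zero    = refl
  θ-1ˢ (suc j) = *-zeroʳ (+ suc j)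
  powerSumSeries-[] : powerSumSeries [] ≗ 0ˢ
  powerSumSeries-[] zero    = refl
  powerSumSeries-[] (suc j) = refl
newton (x ∷ L) j =
  trans (newtonSeries-∷ x L j) (trans (⟨1-t⟩-cong x (newton L) j) (⟨1-t⟩-zero x j))

newton-coefficient : ∀ L n →
  + suc n * elementary L (suc n) + (elementary L ⊛ (λ r → powerSum L (suc r))) n ≡ 0ℤ
newton-coefficient L n =
  trans (cong (λ v → + suc n * elementary L (suc n) + v) (sym (⊛-shift (elementary L) _ (suc n))))
        (newton L (suc n))

EqualUpTo : ℕ → Series → Series → Set
EqualUpTo n F G = ∀ i → i ≤ n → F i ≡ G i

equalUpTo-suc : ∀ {n F G} → EqualUpTo n F G → F (suc n) ≡ G (suc n) → EqualUpTo (suc n) F G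
equalUpTo-suc below top i i≤1+n with ℕ.m≤n⇒m<n∨m≡n i≤1+n
... | inj₁ i<1+n = below i (ℕ.≤-pred i<1+n)
... | inj₂ refl  = top

⊛-equalUpTo : ∀ j {a a' b b'} → EqualUpTo j a a' → EqualUpTo j b b' → (a ⊛ b) j ≡ (a' ⊛ b') j
⊛-equalUpTo zero    ea eb = cong₂ _*_ (ea 0 z≤n) (eb 0 z≤n)
⊛-equalUpTo (suc j) ea eb =
  cong₂ _+_ (cong₂ _*_ (ea 0 z≤n) (eb (suc j) ℕ.≤-refl))
            (⊛-equalUpTo j (λ i i≤j → ea (suc i) (s≤s i≤j)) (λ i i≤j → eb i (ℕ.m≤n⇒m≤1+n i≤j)))

elementary-zero : ∀ L → elementary L 0 ≡ 1ℤ
elementary-zero []      = refl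
elementary-zero (y ∷ L) = cong₂ _+_ (elementary-zero L) (*-zeroʳ (- y))

elementary-vanishes : ∀ L {j} → length L < j → elementary L j ≡ 0ℤ
elementary-vanishes []      {suc j} _          = refl
elementary-vanishes (y ∷ L) {suc j} (s≤s L<j) =
  cong₂ _+_ (elementary-vanishes L (ℕ.m≤n⇒m≤1+n L<j))
            (trans (cong (- y *_) (elementary-vanishes L L<j)) (*-zeroʳ (- y)))

-- Newton's identity in degree n + 1 determines (n + 1) · e_{n+1} from e_0, …, e_n and
-- p_1, …, p_{n+1}; the factor n + 1 ≠ 0 then cancels.
elementary-equalUpTo : ∀ L L' n → (∀ r → 1 ≤ r → r ≤ n → powerSum L r ≡ powerSum L' r) →
                       EqualUpTo n (elementary L) (elementary L')
elementary-equalUpTo L L' zero    _  zero z≤n = trans (elementary-zero L) (sym (elementary-zero L'))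
elementary-equalUpTo L L' (suc n) eq         = equalUpTo-suc below top
  where
  below : EqualUpTo n (elementary L) (elementary L')
  below = elementary-equalUpTo L L' n (λ r 1≤r r≤n → eq r 1≤r (ℕ.m≤n⇒m≤1+n r≤n))
  c c' : ℤ
  c  = (elementary L  ⊛ (λ r → powerSum L  (suc r))) n
  c' = (elementary L' ⊛ (λ r → powerSum L' (suc r))) n
  c≡c' : c ≡ c'
  c≡c' = ⊛-equalUpTo n below (λ i i≤n → eq (suc i) (s≤s z≤n) (s≤s i≤n))
  top : elementary L (suc n) ≡ elementary L' (suc n)
  top = *-cancelˡ-≡ (+ suc n) _ _ (∙-cancelʳ c _ _ (begin
    + suc n * elementary L  (suc n) + c  ≡⟨ newton-coefficient L n ⟩
    0ℤ                                   ≡⟨ newton-coefficient L' n ⟨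
    + suc n * elementary L' (suc n) + c' ≡⟨ cong (λ v → + suc n * elementary L' (suc n) + v) c≡c' ⟨
    + suc n * elementary L' (suc n) + c  ∎))

elementary-≗ : ∀ L L' → length L ≡ length L' →
               (∀ r → 1 ≤ r → r ≤ length L → powerSum L r ≡ powerSum L' r) →
               elementary L ≗ elementary L'
elementary-≗ L L' len eq j with j ℕ.≤? length L
... | yes j≤n = elementary-equalUpTo L L' (length L) eq j j≤n
... | no  j≰n = trans (elementary-vanishes L n<j) (sym (elementary-vanishes L' (subst (_< j) len n<j)))
  where
  n<j : length L < j
  n<j = ℕ.≰⇒> j≰n

-- horner F n t = F 0 * t ^ n + F 1 * t ^ (n ∸ 1) + … + F n: the reversal of the
-- degree-n truncation of F, which turns ∏ (1 - y t) into ∏ (t - y).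
horner : Series → ℕ → ℤ → ℤ
horner F zero    t = F 0
horner F (suc n) t = horner F n t * t + F (suc n)

horner-cong : ∀ {F G} → F ≗ G → ∀ n t → horner F n t ≡ horner G n t
horner-cong e zero    t = e 0
horner-cong e (suc n) t = cong₂ (λ u v → u * t + v) (horner-cong e n t) (e (suc n))

horner-⟨1-t⟩ : ∀ x F n t → horner (⟨1- x t⟩ F) (suc n) t ≡ (t - x) * horner F n t + F (suc n)
horner-⟨1-t⟩ x F zero    t = base (F 0) (F 1) t x
  where
  base : ∀ a b t x → (a + - x * 0ℤ) * t + (b + - x * a) ≡ (t - x) * a + b
  base = solve-∀
horner-⟨1-t⟩ x F (suc n) t = begin
  horner (⟨1- x t⟩ F) (suc n) t * t + (F (suc (suc n)) + - x * F (suc n))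
    ≡⟨ cong (λ h → h * t + _) (horner-⟨1-t⟩ x F n t) ⟩
  ((t - x) * horner F n t + F (suc n)) * t + (F (suc (suc n)) + - x * F (suc n))
    ≡⟨ step (horner F n t) (F (suc n)) (F (suc (suc n))) t x ⟩
  (t - x) * horner F (suc n) t + F (suc (suc n)) ∎
  where
  step : ∀ h a b t x → ((t - x) * h + a) * t + (b + - x * a) ≡ (t - x) * (h * t + a) + b
  step = solve-∀

polyWithRoots : List ℤ → ℤ → ℤ
polyWithRoots L t = foldr (λ y p → (t - y) * p) 1ℤ L

horner-elementary : ∀ L t → horner (elementary L) (length L) t ≡ polyWithRoots L t
horner-elementary []      t = refl
horner-elementary (y ∷ L) t = begin
  horner (⟨1- y t⟩ elementary L) (suc (length L)) t
    ≡⟨ horner-⟨1-t⟩ y (elementary L) (length L) t ⟩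
  (t - y) * horner (elementary L) (length L) t + elementary L (suc (length L))
    ≡⟨ cong₂ (λ u v → (t - y) * u + v) (horner-elementary L t) (elementary-vanishes L ℕ.≤-refl) ⟩
  (t - y) * polyWithRoots L t + 0ℤ
    ≡⟨ +-identityʳ _ ⟩
  polyWithRoots (y ∷ L) t ∎

polyWithRoots≡0⇒∈ : ∀ L {t} → polyWithRoots L t ≡ 0ℤ → t ∈ L
polyWithRoots≡0⇒∈ []      ()
polyWithRoots≡0⇒∈ (y ∷ L) {t} eq =
  [ here ∘ i-j≡0⇒i≡j t y , there ∘ polyWithRoots≡0⇒∈ L ]′ (i*j≡0⇒i≡0∨j≡0 (t - y) eq)

∈⇒↭∷ : ∀ {x : ℤ} {L} → x ∈ L → ∃ λ L' → L ↭ x ∷ L'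
∈⇒↭∷ {x} x∈L with as , bs , refl ← ∈-∃++ x∈L = as ++ bs , ↭-shift x as bs

powerSums⇒∈ : ∀ x L L' → length (x ∷ L) ≡ length L' →
              (∀ r → 1 ≤ r → r ≤ length (x ∷ L) → powerSum (x ∷ L) r ≡ powerSum L' r) → x ∈ L'
powerSums⇒∈ x L L' len eq = polyWithRoots≡0⇒∈ L' (begin
  polyWithRoots L' x                                ≡⟨ horner-elementary L' x ⟨
  horner (elementary L') (length L') x              ≡⟨ cong (λ n → horner (elementary L') n x) len ⟨
  horner (elementary L') (length (x ∷ L)) x         ≡⟨ horner-cong (elementary-≗ (x ∷ L) L' len eq) (length (x ∷ L)) x ⟨
  horner (elementary (x ∷ L)) (length (x ∷ L)) x    ≡⟨ horner-elementary (x ∷ L) x ⟩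
  (x - x) * polyWithRoots L x                       ≡⟨ cong (_* polyWithRoots L x) (+-inverseʳ x) ⟩
  0ℤ                                                ∎)

powerSums⇒↭ : ∀ L L' → length L ≡ length L' →
              (∀ r → 1 ≤ r → r ≤ length L → powerSum L r ≡ powerSum L' r) → L ↭ L'
powerSums⇒↭ []      []      _   _  = ↭-refl
powerSums⇒↭ (x ∷ L) L'      len eq with L'' , L'↭x∷L'' ← ∈⇒↭∷ (powerSums⇒∈ x L L' len eq) =
  ↭-trans (prep x (powerSums⇒↭ L L'' (ℕ.suc-injective (trans len (↭-length L'↭x∷L'')))
                                      (remaining-sums L'↭x∷L'')))
          (↭-sym L'↭x∷L'')
  where
  remaining-sums : ∀ {L''} → L' ↭ x ∷ L'' →
                   ∀ r → 1 ≤ r → r ≤ length L → powerSum L r ≡ powerSum L'' r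
  remaining-sums p r 1≤r r≤n =
    ∙-cancelˡ (x ^ r) _ _ (trans (eq r 1≤r (ℕ.m≤n⇒m≤1+n r≤n)) (powerSum-↭ r p))

sq : ℕ → ℕ
sq n = n ℕ.* n

sq-+ : ∀ u s → sq (u ℕ.+ s) ≡ sq u ℕ.+ (2 ℕ.* (u ℕ.* s) ℕ.+ sq s)
sq-+ = expand
  where
  expand : ∀ u s → (u ℕ.+ s) ℕ.* (u ℕ.+ s) ≡ u ℕ.* u ℕ.+ (2 ℕ.* (u ℕ.* s) ℕ.+ s ℕ.* s)
  expand = ℕ-Solver.solve-∀

sum-sq≤sq-sum : ∀ us → sum (map sq us) ≤ sq (sum us)
sum-sq≤sq-sum []       = z≤n
sum-sq≤sq-sum (u ∷ us) =
  ℕ.≤-trans (ℕ.+-monoʳ-≤ (sq u) (ℕ.≤-trans (sum-sq≤sq-sum us) (ℕ.m≤n+m (sq s) (2 ℕ.* (u ℕ.* s)))))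
            (ℕ.≤-reflexive (sym (sq-+ u s)))
  where
  s : ℕ
  s = sum us

sq-+-tight : ∀ u s q → q ≤ sq s → sq (u ℕ.+ s) ≡ sq u ℕ.+ q → (u ≡ 0 ⊎ s ≡ 0) × sq s ≡ q
sq-+-tight u s q q≤s² tight = u≡0⊎s≡0 , trans (sym (cong (ℕ._+ sq s) cross≡0)) rest
  where
  rest : 2 ℕ.* (u ℕ.* s) ℕ.+ sq s ≡ q
  rest = ℕ.+-cancelˡ-≡ (sq u) _ _ (trans (sym (sq-+ u s)) tight)
  cross≡0 : 2 ℕ.* (u ℕ.* s) ≡ 0
  cross≡0 = ℕ.n≤0⇒n≡0 (ℕ.+-cancelʳ-≤ (sq s) _ 0 (subst (_≤ sq s) (sym rest) q≤s²))
  u≡0⊎s≡0 : u ≡ 0 ⊎ s ≡ 0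
  u≡0⊎s≡0 = ℕ.m*n≡0⇒m≡0∨n≡0 u (ℕ.m*n≡0⇒m≡0 (u ℕ.* s) 2 (trans (ℕ.*-comm (u ℕ.* s) 2) cross≡0))

squares : List ℤ → List ℕ
squares = map (sq ∘ ∣_∣)

i*i≡+sq∣i∣ : ∀ i → i * i ≡ + sq ∣ i ∣
i*i≡+sq∣i∣ (+ n)    = sym (pos-* n n)
i*i≡+sq∣i∣ -[1+ n ] = refl

powerSum-nonneg : ∀ r (f : ℤ → ℕ) → (∀ y → y ^ r ≡ + f y) → ∀ L → powerSum L r ≡ + sum (map f L)
powerSum-nonneg r f pow []      = refl
powerSum-nonneg r f pow (y ∷ L) =
  trans (cong₂ _+_ (pow y) (powerSum-nonneg r f pow L)) (sym (pos-+ (f y) (sum (map f L))))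

powerSum-2 : ∀ L → powerSum L 2 ≡ + sum (squares L)
powerSum-2 = powerSum-nonneg 2 (sq ∘ ∣_∣) (λ y → trans (cong (y *_) (*-identityʳ y)) (i*i≡+sq∣i∣ y))

powerSum-4 : ∀ L → powerSum L 4 ≡ + sum (map sq (squares L))
powerSum-4 L = trans (powerSum-nonneg 4 (sq ∘ sq ∘ ∣_∣) fourth L) (cong (+_ ∘ sum) (map-∘ L))
  where
  fourth : ∀ y → y ^ 4 ≡ + sq (sq ∣ y ∣)
  fourth y = begin
    y ^ 4                   ≡⟨ regroup y ⟩
    (y * y) * (y * y)       ≡⟨ cong₂ _*_ (i*i≡+sq∣i∣ y) (i*i≡+sq∣i∣ y) ⟩
    + sq ∣ y ∣ * + sq ∣ y ∣ ≡⟨ pos-* (sq ∣ y ∣) (sq ∣ y ∣) ⟨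
    + sq (sq ∣ y ∣)         ∎
    where
    regroup : ∀ y → y * (y * (y * (y * 1ℤ))) ≡ (y * y) * (y * y)
    regroup = solve-∀

sq∣i∣≡0⇒i≡0 : ∀ {i} → sq ∣ i ∣ ≡ 0 → i ≡ 0ℤ
sq∣i∣≡0⇒i≡0 {i} eq = ∣i∣≡0⇒i≡0 (reduce (ℕ.m*n≡0⇒m≡0∨n≡0 ∣ i ∣ eq))

sum-squares≡0 : ∀ L → sum (squares L) ≡ 0 → L ≡ replicate (length L) 0ℤ
sum-squares≡0 []      _  = refl
sum-squares≡0 (y ∷ L) eq =
  cong₂ _∷_ (sq∣i∣≡0⇒i≡0 (ℕ.m+n≡0⇒m≡0 _ eq)) (sum-squares≡0 L (ℕ.m+n≡0⇒n≡0 (sq ∣ y ∣) eq))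

concentrated : ∀ y L → sq (sum (squares (y ∷ L))) ≡ sum (map sq (squares (y ∷ L))) →
               (y ∷ L) ↭ powerSum (y ∷ L) 1 ∷ replicate (length L) 0ℤ
concentrated y L tight
  with sq-+-tight (sq ∣ y ∣) (sum (squares L)) _ (sum-sq≤sq-sum (squares L)) tight
... | inj₂ rest≡0 , _ = ↭-reflexive (cong₂ _∷_ (sym sum≡y) zeros)
  where
  zeros : L ≡ replicate (length L) 0ℤ
  zeros = sum-squares≡0 L rest≡0
  sum≡y : powerSum (y ∷ L) 1 ≡ y
  sum≡y = begin
    powerSum (y ∷ L) 1                            ≡⟨ cong (λ M → powerSum (y ∷ M) 1) zeros ⟩
    powerSum ([ y ] ++ replicate (length L) 0ℤ) 1 ≡⟨ powerSum-padding [ y ] (length L) 0 ⟩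
    y ^ 1 + 0ℤ                                    ≡⟨ +-identityʳ (y ^ 1) ⟩
    y ^ 1                                         ≡⟨ ^-identityʳ y ⟩
    y                                             ∎
concentrated y []       tight | inj₁ _ , _ =
  ↭-reflexive (cong [_] (sym (trans (+-identityʳ (y ^ 1)) (^-identityʳ y))))
concentrated y (y' ∷ L) tight | inj₁ y²≡0 , tight' with refl ← sq∣i∣≡0⇒i≡0 {y} y²≡0 =
  ↭-trans (prep 0ℤ (concentrated y' L tight'))
          (↭-trans (swap 0ℤ (powerSum (y' ∷ L) 1) ↭-refl)
                   (↭-reflexive (cong (_∷ 0ℤ ∷ replicate (length L) 0ℤ) (sym (+-identityˡ _)))))

IsSolution-sym : ∀ {k s₁ s₂} (xs : Vec ℤ s₁) (ys : Vec ℤ s₂) → IsSolution k xs ys → IsSolution k ys xs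
IsSolution-sym xs ys sol r 1≤r r≤k = sym (sol r 1≤r r≤k)

Trivial-sym : ∀ {s₁ s₂} (xs : Vec ℤ s₁) (ys : Vec ℤ s₂) → Trivial xs ys → Trivial ys xs
Trivial-sym xs ys = Sum.swap

padded-↭ : ∀ {k s₁ s₂} (xs : Vec ℤ s₁) (ys : Vec ℤ s₂) → s₁ ≤ s₂ → s₂ ≤ k → IsSolution k xs ys →
           toList ys ↭ toList xs ++ replicate (s₂ ∸ s₁) 0ℤ
padded-↭ {s₁ = s₁} {s₂} xs ys s₁≤s₂ s₂≤k sol = powerSums⇒↭ (toList ys) padded lengths sums
  where
  padded : List ℤ
  padded = toList xs ++ replicate (s₂ ∸ s₁) 0ℤ
  lengths : length (toList ys) ≡ length padded
  lengths = begin
    length (toList ys)                                       ≡⟨ length-toList ys ⟩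
    s₂                                                       ≡⟨ ℕ.m+[n∸m]≡n s₁≤s₂ ⟨
    s₁ ℕ.+ (s₂ ∸ s₁)                                         ≡⟨ cong₂ ℕ._+_ (length-toList xs) (length-replicate (s₂ ∸ s₁)) ⟨
    length (toList xs) ℕ.+ length (replicate (s₂ ∸ s₁) 0ℤ)   ≡⟨ length-++ (toList xs) ⟨
    length padded                                            ∎
  sums : ∀ r → 1 ≤ r → r ≤ length (toList ys) → powerSum (toList ys) r ≡ powerSum padded r
  sums (suc r) 1≤r r≤s₂ =
    trans (sym (sol (suc r) 1≤r (ℕ.≤-trans (subst (suc r ≤_) (length-toList ys) r≤s₂) s₂≤k)))
          (sym (powerSum-padding (toList xs) (s₂ ∸ s₁) r))

short-solution-trivial : ∀ {k s₁ s₂} (xs : Vec ℤ s₁) (ys : Vec ℤ s₂) →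
                         s₁ ⊔ s₂ ≤ k → IsSolution k xs ys → Trivial xs ys
short-solution-trivial {s₁ = s₁} {s₂} xs ys ≤k sol with ℕ.≤-total s₁ s₂
... | inj₁ s₁≤s₂ = inj₁ (s₁≤s₂ , padded-↭ xs ys s₁≤s₂ (ℕ.≤-trans (ℕ.m≤n⊔m s₁ s₂) ≤k) sol)
... | inj₂ s₂≤s₁ = inj₂ (s₂≤s₁ , padded-↭ ys xs s₂≤s₁ (ℕ.≤-trans (ℕ.m≤m⊔n s₁ s₂) ≤k) (IsSolution-sym xs ys sol))

singleton-solution-trivial : ∀ {k s₂} x (ys : Vec ℤ s₂) → 1 ≤ s₂ → 4 ≤ k →
                             IsSolution k (x ∷ []) ys → Trivial (x ∷ []) ys
singleton-solution-trivial x (y ∷ ys) _ 4≤k sol =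
  inj₁ (s≤s z≤n , ↭-trans (concentrated y L tight)
                          (↭-reflexive (cong₂ (λ z m → z ∷ replicate m 0ℤ) sum≡x (length-toList ys))))
  where
  L : List ℤ
  L = toList ys
  sol≤4 : ∀ r → 1 ≤ r → r ≤ 4 → powerSum [ x ] r ≡ powerSum (y ∷ L) r
  sol≤4 r 1≤r r≤4 = sol r 1≤r (ℕ.≤-trans r≤4 4≤k)
  sum≡x : powerSum (y ∷ L) 1 ≡ x
  sum≡x = trans (sym (sol≤4 1 ℕ.≤-refl (s≤s z≤n))) (trans (+-identityʳ (x ^ 1)) (^-identityʳ x))
  tight : sq (sum (squares (y ∷ L))) ≡ sum (map sq (squares (y ∷ L)))
  tight = +-injective (begin
    + sq S                                  ≡⟨ pos-* S S ⟩
    + S * + S                               ≡⟨ cong₂ _*_ (powerSum-2 (y ∷ L)) (powerSum-2 (y ∷ L)) ⟨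
    powerSum (y ∷ L) 2 * powerSum (y ∷ L) 2 ≡⟨ cong₂ _*_ x²≡ x²≡ ⟨
    powerSum [ x ] 2 * powerSum [ x ] 2     ≡⟨ square (x ^ 2) ⟩
    x ^ 2 * x ^ 2 + 0ℤ                      ≡⟨ cong (_+ 0ℤ) (^-distribˡ-+-* x 2 2) ⟨
    powerSum [ x ] 4                        ≡⟨ sol≤4 4 (s≤s z≤n) ℕ.≤-refl ⟩
    powerSum (y ∷ L) 4                      ≡⟨ powerSum-4 (y ∷ L) ⟩
    + sum (map sq (squares (y ∷ L)))        ∎)
    where
    S : ℕ
    S = sum (squares (y ∷ L))
    x²≡ : powerSum [ x ] 2 ≡ powerSum (y ∷ L) 2
    x²≡ = sol≤4 2 (s≤s z≤n) (s≤s (s≤s z≤n))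
    square : ∀ p → (p + 0ℤ) * (p + 0ℤ) ≡ p * p + 0ℤ
    square = solve-∀

nontrivial⇒2≤length : ∀ {k s₁ s₂} (xs : Vec ℤ s₁) (ys : Vec ℤ s₂) → 1 ≤ s₁ → 1 ≤ s₂ → 4 ≤ k →
                      IsSolution k xs ys → ¬ Trivial xs ys → 2 ≤ s₁
nontrivial⇒2≤length (x ∷ [])     ys _ 1≤s₂ 4≤k sol nontrivial =
  ⊥-elim (nontrivial (singleton-solution-trivial x ys 1≤s₂ 4≤k sol))
nontrivial⇒2≤length (_ ∷ _ ∷ _) _  _ _    _   _   _          = s≤s (s≤s z≤n)

lemma1 : (k s₁ s₂ : ℕ) → 1 ≤ k → 1 ≤ s₁ → 1 ≤ s₂ →
    (xs : Vec ℤ s₁) → (ys : Vec ℤ s₂) →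
    IsSolution k xs ys → ¬ Trivial xs ys →
    (suc k ≤ s₁ ⊔ s₂) × (4 ≤ k → 2 ≤ s₁ ⊓ s₂)
lemma1 k s₁ s₂ _ 1≤s₁ 1≤s₂ xs ys sol nontrivial = long , wide
  where
  long : suc k ≤ s₁ ⊔ s₂
  long = ℕ.≰⇒> λ ≤k → nontrivial (short-solution-trivial xs ys ≤k sol)
  wide : 4 ≤ k → 2 ≤ s₁ ⊓ s₂
  wide 4≤k = ℕ.⊓-glb (nontrivial⇒2≤length xs ys 1≤s₁ 1≤s₂ 4≤k sol nontrivial)
                     (nontrivial⇒2≤length ys xs 1≤s₂ 1≤s₁ 4≤k (IsSolution-sym xs ys sol) (nontrivial ∘ Trivial-sym ys xs))
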